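{- Let $D=(X,Y,E)$ be a finite bitournament. Then the following are equivalent: (1) $D$ is bitransitive; (2) $D$ has no directed $4$-cycle; (3) $D$ has no directed cycle; (4) the adjacency matrix of $D$, with rows and columns ordered as $X$ then $Y$, has the block form $\begin{pmatrix} \mathbf{0} & A\\ \overline{A}^{\,T} & \mathbf{0}\end{pmatrix}$, where $A$ is the $|X|\times|Y|$ $(0,1)$-matrix with $A_{xy}=1$ iff $xy\in E$, $\overline{A}$ is obtained from $A$ by interchanging $0$'s and $1$'s, and $A$ is the adjacency matrix of a Ferrers digraph, i.e. $A$ contains no $2\times 2$ submatrix equal to $\begin{pmatrix}1&0\\0&1\end{pmatrix}$ or $\begin{pmatrix}0&1\\1&0\end{pmatrix}$; (5) $D\cong D_S$ (as directed graphs) for some nonempty $S\subseteq\mathbb{N}$.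
   Context: An oriented bipartite graph $D=(X,Y,E)$ consists of nonempty disjoint vertex sets $X,Y$ and an arc set $E\subseteq (X\times Y)\cup(Y\times X)$ such that for no $x\in X,y\in Y$ are both $(x,y)$ and $(y,x)$ in $E$; an arc $(u,v)$ is written $uv$. $D$ is a bitournament if for all $x\in X$, $y\in Y$ exactly one of $xy, yx$ lies in $E$. $D$ is bitransitive if for all $x_1,x_2\in X$ and $y_1,y_2\in Y$: $x_1y_1,\ y_1x_2,\ x_2y_2\in E$ implies $x_1y_2\in E$. For a nonempty $S\subseteq\mathbb{N}$, $D_S$ is the digraph with vertex set $S$ and an arc $a\to b$ iff $b>a$ and $a,b$ have opposite parity. A Ferrers digraph is one whose out-neighbourhoods (successor sets) are linearly ordered by inclusion; equivalently its adjacency matrix has no $2\times2$ permutation submatrix. -}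

module Defs where

open import Data.Nat as ℕ using (ℕ; zero; suc; _%_)
open import Data.Fin as Fin using (Fin; zero; suc; splitAt; inject₁; fromℕ)
open import Data.Bool using (Bool; true; false; not; T)
open import Data.Sum using (_⊎_; inj₁; inj₂)
open import Data.Product using (Σ; ∃; _×_; _,_)
open import Relation.Nullary using (¬_)
open import Relation.Binary.PropositionalEquality using (_≡_; _≢_)
open import Function.Definitions using (Injective)
open import Function.Bundles using (_↔_; _⇔_; Inverse)

V : ℕ → ℕ → Set
V m n = Fin m ⊎ Fin n

ArcSet : ℕ → ℕ → Set
ArcSet m n = V m n → V m n → Bool

Arc : ∀ {m n} → ArcSet m n → V m n → V m n → Set
Arc E u v = T (E u v)

record IsOrientedBipartite {m n : ℕ} (E : ArcSet m n) : Set where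
  field
    X-nonempty : 0 ℕ.< m
    Y-nonempty : 0 ℕ.< n
    noArcXX    : ∀ (x x′ : Fin m) → ¬ Arc E (inj₁ x) (inj₁ x′)
    noArcYY    : ∀ (y y′ : Fin n) → ¬ Arc E (inj₂ y) (inj₂ y′)
    oriented   : ∀ (x : Fin m) (y : Fin n) →
                 ¬ (Arc E (inj₁ x) (inj₂ y) × Arc E (inj₂ y) (inj₁ x))

record IsBitournament {m n : ℕ} (E : ArcSet m n) : Set where
  field
    isOrientedBipartite : IsOrientedBipartite E
    complete : ∀ (x : Fin m) (y : Fin n) →
               Arc E (inj₁ x) (inj₂ y) ⊎ Arc E (inj₂ y) (inj₁ x)

Bitransitive : ∀ {m n} → ArcSet m n → Set
Bitransitive {m} {n} E = ∀ (x₁ x₂ : Fin m) (y₁ y₂ : Fin n) →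
  Arc E (inj₁ x₁) (inj₂ y₁) → Arc E (inj₂ y₁) (inj₁ x₂) →
  Arc E (inj₁ x₂) (inj₂ y₂) → Arc E (inj₁ x₁) (inj₂ y₂)

-- Cyclic successor on Fin (suc k).
next : ∀ {k} → Fin (suc k) → Fin (suc k)
next {zero}  zero    = zero
next {suc k} zero    = suc zero
next {suc k} (suc i) with next {k} i
... | zero  = zero
... | suc j = suc (suc j)

-- A directed cycle of length suc k (parameter k = length - 1): suc k distinct vertices c₀,…,c_k
-- with arcs c_i → c_{i+1 mod (suc k)}.
DirectedCycleOfLength1+ : ∀ {m n} → ArcSet m n → ℕ → Set
DirectedCycleOfLength1+ {m} {n} E k =
  Σ (Fin (suc k) → V m n) λ c → Injective _≡_ _≡_ c ×
    (∀ (i : Fin (suc k)) → Arc E (c i) (c (next i)))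

NoDirected4Cycle : ∀ {m n} → ArcSet m n → Set
NoDirected4Cycle E = ¬ DirectedCycleOfLength1+ E 3

-- (3) no directed cycle (of any length ≥ 2; length-1 cycles = loops are
-- included too: ℓ = suc k ranges over all lengths ≥ 1)
NoDirectedCycle : ∀ {m n} → ArcSet m n → Set
NoDirectedCycle E = ∀ k → ¬ DirectedCycleOfLength1+ E k

adjMatrix : ∀ {m n} → ArcSet m n → Fin (m ℕ.+ n) → Fin (m ℕ.+ n) → Bool
adjMatrix {m} E i j = E (splitAt m i) (splitAt m j)

matA : ∀ {m n} → ArcSet m n → Fin m → Fin n → Bool
matA E x y = E (inj₁ x) (inj₂ y)

blockMatrix : ∀ {m n} → (Fin m → Fin n → Bool) → Fin (m ℕ.+ n) → Fin (m ℕ.+ n) → Bool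
blockMatrix {m} A i j = go (splitAt m i) (splitAt m j)
  where
    go : _ → _ → Bool
    go (inj₁ x) (inj₁ x′) = false
    go (inj₁ x) (inj₂ y)  = A x y
    go (inj₂ y) (inj₁ x)  = not (A x y)
    go (inj₂ y) (inj₂ y′) = false

FerrersMatrix : ∀ {m n} → (Fin m → Fin n → Bool) → Set
FerrersMatrix {m} {n} A = ∀ (i₁ i₂ : Fin m) (j₁ j₂ : Fin n) → i₁ Fin.< i₂ → j₁ Fin.< j₂ →
  ¬ (A i₁ j₁ ≡ true × A i₁ j₂ ≡ false × A i₂ j₁ ≡ false × A i₂ j₂ ≡ true) ×
  ¬ (A i₁ j₁ ≡ false × A i₁ j₂ ≡ true × A i₂ j₁ ≡ true × A i₂ j₂ ≡ false)

BlockFerrersForm : ∀ {m n} → ArcSet m n → Set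
BlockFerrersForm E =
  (∀ i j → adjMatrix E i j ≡ blockMatrix (matA E) i j) × FerrersMatrix (matA E)

VS : (ℕ → Bool) → Set
VS S = Σ ℕ λ a → T (S a)

DSArc : ∀ {S} → VS S → VS S → Set
DSArc (a , _) (b , _) = a ℕ.< b × a % 2 ≢ b % 2

IsoToSomeDS : ∀ {m n} → ArcSet m n → Set
IsoToSomeDS {m} {n} E =
  Σ (ℕ → Bool) λ S → VS S × Σ (V m n ↔ VS S) λ f →
    ∀ u v → Arc E u v ⇔ DSArc {S} (Inverse.to f u) (Inverse.to f v)

-- A bitransitive bitournament is exactly one whose matrix A is Ferrers, i.e. whose rows are
-- nested. Nested rows make A a threshold matrix: there are ranks r on X and s on Y with
-- xy ∈ E iff r x < s y. Placing x at 2 r x + 1 and y at 2 s y on the number line turns D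
-- into a copy of D_S (after spreading out ties), and in D_S every arc goes up, so there is
-- no cycle at all. Conversely, a failure of bitransitivity together with completeness
-- produces a directed 4-cycle x₁ y₁ x₂ y₂.
module Submission where

open import Defs
open import Data.Nat using (ℕ; suc; _+_; _*_; _<_; _≤_; _%_; _≟_; s≤s; s≤s⁻¹)
open import Data.Product using (_×_; _,_; proj₁; proj₂)
open import Function.Bundles using (_⇔_; _↔_; Inverse; Equivalence; mk⇔; mk↔ₛ′)

open import Data.Bool using (Bool; true; false; not)
open import Data.Bool.Properties using (T-≡; T-irrelevant; not-¬; ¬-not; not-involutive)
open import Data.Empty using (⊥-elim)
open import Data.Fin using (Fin; zero; suc; toℕ; splitAt; join; fromℕ<)
open import Data.Fin.Properties using (any?; toℕ<n; toℕ-injective; splitAt-join; <-cmp)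
open import Data.Fin.Subset using (Subset; _∈_; _⊆_; ∣_∣)
open import Data.Fin.Subset.Properties using (_⊆?_; p⊆q⇒∣p∣≤∣q∣; p⊂q⇒∣p∣<∣q∣)
open import Data.List using (allFin)
open import Data.List.Extrema.Nat using (argmax; f[xs]≤f[argmax])
open import Data.List.Membership.Propositional.Properties using (∈-allFin)
import Data.List.Relation.Unary.All as All
open import Data.Nat.DivMod using ([m+kn]%n≡m%n; m*n%n≡0)
open import Data.Nat.Properties as ℕ
  using (+-comm; +-monoʳ-<; +-mono-<-≤; *-monoˡ-≤; *-cancelʳ-≤; *-cancelʳ-≡; +-cancelˡ-≡;
         m≤m+n; <⇒≤; <⇒≢; <⇒≱; <-asym; <-irrefl; <-≤-trans; module ≤-Reasoning)
open import Data.Sum using (_⊎_; inj₁; inj₂)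
open import Data.Sum.Properties using (inj₁-injective; inj₂-injective)
open import Data.Unit using (tt)
open import Data.Vec using (tabulate)
open import Data.Vec.Properties using (lookup∘tabulate; []=⇒lookup; lookup⇒[]=)
open import Function using (_∘_; id)
open import Function.Definitions using (Injective)
import Function.Properties.Equivalence as ⇔
open import Relation.Binary using (tri<; tri≈; tri>)
open import Relation.Binary.PropositionalEquality
  using (_≡_; _≢_; refl; sym; trans; cong; module ≡-Reasoning)
open import Relation.Nullary using (contradiction)
open import Relation.Nullary.Decidable using (isYes; toWitness; fromWitness)

open Equivalence using (to; from)

private
  variable
    k m n : ℕ

∈-tabulate : {P : Fin k → Bool} {i : Fin k} → i ∈ tabulate P ⇔ P i ≡ true
∈-tabulate {P = P} {i} = mk⇔
  (λ i∈P → trans (sym (lookup∘tabulate P i)) ([]=⇒lookup i∈P))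
  (λ Pi → lookup⇒[]= i (tabulate P) (trans (lookup∘tabulate P i) Pi))

zeros : (Fin k → Bool) → Subset k
zeros f = tabulate (not ∘ f)

∈-zeros : {f : Fin k → Bool} {i : Fin k} → i ∈ zeros f ⇔ f i ≡ false
∈-zeros {f = f} {i} = ⇔.trans ∈-tabulate
  (mk⇔ (λ e → trans (sym (not-involutive (f i))) (cong not e)) (cong not))

-- Ferrers matrices are threshold matrices

Matrix : ℕ → ℕ → Set
Matrix m n = Fin m → Fin n → Bool

-- Rows linearly ordered by inclusion: a 1 of row i₁ over a 0 of row i₂ forces row i₂ ⊆ row i₁.
-- Unlike FerrersMatrix, no ordering of the indices is involved.
Ferrers : Matrix m n → Set
Ferrers A = ∀ i₁ i₂ j₁ j₂ →
  A i₁ j₁ ≡ true → A i₂ j₁ ≡ false → A i₂ j₂ ≡ true → A i₁ j₂ ≡ true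

ferrersMatrix⇔ferrers : {A : Matrix m n} → FerrersMatrix A ⇔ Ferrers A
ferrersMatrix⇔ferrers {A = A} = mk⇔ unordered ordered
  where
  unordered : FerrersMatrix A → Ferrers A
  unordered fm i₁ i₂ j₁ j₂ a₁₁ a₂₁ a₂₂ with A i₁ j₂ in a₁₂
  ... | true  = refl
  ... | false with <-cmp i₁ i₂ | <-cmp j₁ j₂
  ... | tri≈ _ refl _ | _ = contradiction a₂₁ (not-¬ a₁₁)
  ... | _ | tri≈ _ refl _ = contradiction a₂₁ (not-¬ a₂₂)
  ... | tri< i< _ _ | tri< j< _ _ = ⊥-elim (proj₁ (fm i₁ i₂ j₁ j₂ i< j<) (a₁₁ , a₁₂ , a₂₁ , a₂₂))
  ... | tri< i< _ _ | tri> _ _ j> = ⊥-elim (proj₂ (fm i₁ i₂ j₂ j₁ i< j>) (a₁₂ , a₁₁ , a₂₂ , a₂₁))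
  ... | tri> _ _ i> | tri< j< _ _ = ⊥-elim (proj₂ (fm i₂ i₁ j₁ j₂ i> j<) (a₂₁ , a₂₂ , a₁₁ , a₁₂))
  ... | tri> _ _ i> | tri> _ _ j> = ⊥-elim (proj₁ (fm i₂ i₁ j₂ j₁ i> j>) (a₂₂ , a₂₁ , a₁₂ , a₁₁))

  ordered : Ferrers A → FerrersMatrix A
  ordered fer i₁ i₂ j₁ j₂ _ _ =
    (λ (a₁₁ , a₁₂ , a₂₁ , a₂₂) → not-¬ (fer i₁ i₂ j₁ j₂ a₁₁ a₂₁ a₂₂) a₁₂) ,
    (λ (a₁₁ , a₁₂ , a₂₁ , a₂₂) → not-¬ (fer i₁ i₂ j₂ j₁ a₁₂ a₂₂ a₂₁) a₁₁)

column : Matrix m n → Fin n → Fin m → Bool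
column A j i = A i j

-- Columns j′ with no more 1s than column j, in the pointwise order.
dominatedBy : Matrix m n → Fin n → Subset n
dominatedBy A j = tabulate (λ j′ → isYes (zeros (column A j) ⊆? zeros (column A j′)))

∈-dominatedBy : {A : Matrix m n} {j j′ : Fin n} →
  j′ ∈ dominatedBy A j ⇔ zeros (column A j) ⊆ zeros (column A j′)
∈-dominatedBy = ⇔.trans ∈-tabulate (⇔.trans (⇔.sym T-≡) (mk⇔ toWitness fromWitness))

rowRank : Matrix m n → Fin m → ℕ
rowRank A i = ∣ zeros (A i) ∣

columnRank : Matrix m n → Fin n → ℕ
columnRank A j = ∣ dominatedBy A j ∣

rowRank<columnRank : {A : Matrix m n} → Ferrers A →
  ∀ {i j} → A i j ≡ true → rowRank A i < columnRank A j
rowRank<columnRank {A = A} fer {i} {j} aᵢⱼ =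
  p⊂q⇒∣p∣<∣q∣ (zeros⊆dominated , j , from ∈-dominatedBy id , not-¬ aᵢⱼ ∘ to ∈-zeros)
  where
  zeros⊆dominated : zeros (A i) ⊆ dominatedBy A j
  zeros⊆dominated j′∈ = from ∈-dominatedBy λ {i′} i′∈ → from ∈-zeros
    (¬-not λ aᵢ′ⱼ′ → not-¬ (fer i′ i _ j aᵢ′ⱼ′ (to ∈-zeros j′∈) aᵢⱼ) (to ∈-zeros i′∈))

columnRank≤rowRank : {A : Matrix m n} →
  ∀ {i j} → A i j ≡ false → columnRank A j ≤ rowRank A i
columnRank≤rowRank {A = A} {i} {j} aᵢⱼ =
  p⊆q⇒∣p∣≤∣q∣ {p = dominatedBy A j} {q = zeros (A i)} λ j′∈ →
  from ∈-zeros (to ∈-zeros (to ∈-dominatedBy j′∈ (from ∈-zeros aᵢⱼ)))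

threshold : {A : Matrix m n} → Ferrers A →
  ∀ {i j} → A i j ≡ true ⇔ rowRank A i < columnRank A j
threshold {A = A} fer {i} {j} = mk⇔ (rowRank<columnRank fer) below
  where
  below : rowRank A i < columnRank A j → A i j ≡ true
  below r<s with A i j in aᵢⱼ
  ... | true  = refl
  ... | false = contradiction (columnRank≤rowRank {A = A} aᵢⱼ) (<⇒≱ r<s)

_⇝_ : ℕ → ℕ → Set
a ⇝ b = a < b × a % 2 ≢ b % 2

odd<even⇔ : ∀ {r s} → r < s ⇔ suc (r * 2) < s * 2
odd<even⇔ {r} {s} = mk⇔ (*-monoˡ-≤ 2) (*-cancelʳ-≤ (suc r) s 2)

even<odd⇔ : ∀ {r s} → s ≤ r ⇔ s * 2 < suc (r * 2)
even<odd⇔ {r} {s} = mk⇔ (s≤s ∘ *-monoˡ-≤ 2) (*-cancelʳ-≤ s r 2 ∘ s≤s⁻¹)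

odd%2 : ∀ r → suc (r * 2) % 2 ≡ 1
odd%2 r = [m+kn]%n≡m%n 1 r 2

even%2 : ∀ s → (s * 2) % 2 ≡ 0
even%2 s = m*n%n≡0 s 2

odd≢even : ∀ r s → suc (r * 2) % 2 ≢ (s * 2) % 2
odd≢even r s e with trans (sym (odd%2 r)) (trans e (even%2 s))
... | ()

-- a + 2(aN + i) keeps the parity of a and is lexicographic in (a, i) for i < N.
spread : ℕ → ℕ → ℕ → ℕ
spread N a i = a + (a * N + i) * 2

spread%2 : ∀ N a i → spread N a i % 2 ≡ a % 2
spread%2 N a i = [m+kn]%n≡m%n a (a * N + i) 2

lexicographic-< : ∀ {N a b i} j → i < N → a < b → a * N + i < b * N + j
lexicographic-< {N} {a} {b} {i} j i<N a<b = begin-strict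
  a * N + i  <⟨ +-monoʳ-< (a * N) i<N ⟩
  a * N + N  ≡⟨ +-comm (a * N) N ⟩
  suc a * N  ≤⟨ *-monoˡ-≤ N a<b ⟩
  b * N      ≤⟨ m≤m+n (b * N) j ⟩
  b * N + j  ∎
  where open ≤-Reasoning

spread-monoˡ-< : ∀ {N a b i} j → i < N → a < b → spread N a i < spread N b j
spread-monoˡ-< j i<N a<b = +-mono-<-≤ a<b (*-monoˡ-≤ 2 (<⇒≤ (lexicographic-< j i<N a<b)))

spread-injectiveʳ : ∀ {N a b i j} → i < N → j < N → spread N a i ≡ spread N b j → i ≡ j
spread-injectiveʳ {N} {a} {b} {i} {j} i<N j<N eq with ℕ.<-cmp a b
... | tri< a<b _ _ = contradiction eq (<⇒≢ (spread-monoˡ-< j i<N a<b))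
... | tri> _ _ b<a = contradiction (sym eq) (<⇒≢ (spread-monoˡ-< i j<N b<a))
... | tri≈ _ refl _ = +-cancelˡ-≡ (a * N) i j (*-cancelʳ-≡ _ _ 2 (+-cancelˡ-≡ a _ _ eq))

⇝-spread : ∀ {N a b i j} → i < N → j < N → a ⇝ b ⇔ spread N a i ⇝ spread N b j
⇝-spread {N} {a} {b} {i} {j} i<N j<N = mk⇔
  (λ (a<b , a≢b) → spread-monoˡ-< j i<N a<b , a≢b ∘ to parity⇔)
  (λ (lt , ≢) → increasing lt (≢ ∘ from parity⇔) , ≢ ∘ from parity⇔)
  where
  parity⇔ : spread N a i % 2 ≡ spread N b j % 2 ⇔ a % 2 ≡ b % 2
  parity⇔ = mk⇔
    (λ e → trans (sym (spread%2 N a i)) (trans e (spread%2 N b j)))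
    (λ e → trans (spread%2 N a i) (trans e (sym (spread%2 N b j))))

  increasing : spread N a i < spread N b j → a % 2 ≢ b % 2 → a < b
  increasing lt a≢b with ℕ.<-cmp a b
  ... | tri< a<b _ _ = a<b
  ... | tri≈ _ refl _ = contradiction refl a≢b
  ... | tri> _ _ b<a = contradiction (spread-monoˡ-< i j<N b<a) (<-asym lt)

Image : (V m n → ℕ) → ℕ → Bool
Image {m} f a = isYes (any? λ i → f (splitAt m i) ≟ a)

VS-≡ : {S : ℕ → Bool} {w w′ : VS S} → proj₁ w ≡ proj₁ w′ → w ≡ w′
VS-≡ {w = a , p} {.a , q} refl = cong (a ,_) (T-irrelevant p q)

↔Image : (f : V m n → ℕ) → Injective _≡_ _≡_ f → V m n ↔ VS (Image f)
↔Image {m} {n} f f-injective =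
  mk↔ₛ′ into out (λ w → VS-≡ (f∘out w)) (λ u → f-injective (f∘out (into u)))
  where
  into : V m n → VS (Image f)
  into u = f u , fromWitness (join m n u , cong f (splitAt-join m n u))

  out : VS (Image f) → V m n
  out (_ , a∈) = splitAt m (proj₁ (toWitness a∈))

  f∘out : ∀ w → f (out w) ≡ proj₁ w
  f∘out (_ , a∈) = proj₂ (toWitness a∈)

-- Any labelling of the vertices that pulls D_ℕ back to E, injective or not, exhibits E as
-- a copy of D_S once ties are broken by the vertex index.
pullbackOfDℕ⇒isoToSomeDS : {E : ArcSet m n} → V m n → (level : V m n → ℕ) →
  (∀ u v → Arc E u v ⇔ level u ⇝ level v) → IsoToSomeDS E
pullbackOfDℕ⇒isoToSomeDS {m} {n} v₀ level arc⇔ =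
  Image code , Inverse.to iso v₀ , iso ,
  λ u v → ⇔.trans (arc⇔ u v) (⇝-spread (index<N u) (index<N v))
  where
  index : V m n → ℕ
  index v = toℕ (join m n v)

  index<N : ∀ v → index v < m + n
  index<N v = toℕ<n (join m n v)

  code : V m n → ℕ
  code v = spread (m + n) (level v) (index v)

  code-injective : Injective _≡_ _≡_ code
  code-injective {u} {v} eq = begin
    u                       ≡⟨ sym (splitAt-join m n u) ⟩
    splitAt m (join m n u)  ≡⟨ cong (splitAt m) (toℕ-injective index≡) ⟩
    splitAt m (join m n v)  ≡⟨ splitAt-join m n v ⟩
    v                       ∎
    where
    open ≡-Reasoning
    index≡ : index u ≡ index v
    index≡ = spread-injectiveʳ {a = level u} {b = level v} (index<N u) (index<N v) eq

  iso : V m n ↔ VS (Image code)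
  iso = ↔Image code code-injective

ranking⇒noDirectedCycle : {E : ArcSet m n} (f : V m n → ℕ) →
  (∀ {u v} → Arc E u v → f u < f v) → NoDirectedCycle E
ranking⇒noDirectedCycle f increasing k (c , _ , arcs) =
  <-irrefl refl (<-≤-trans (increasing (arcs top)) (top-max (next top)))
  where
  top : Fin (suc k)
  top = argmax (f ∘ c) zero (allFin (suc k))

  top-max : ∀ i → f (c i) ≤ f (c top)
  top-max i = All.lookup (f[xs]≤f[argmax] {f = f ∘ c} zero (allFin (suc k))) (∈-allFin i)

isoToSomeDS⇒noDirectedCycle : {E : ArcSet m n} → IsoToSomeDS E → NoDirectedCycle E
isoToSomeDS⇒noDirectedCycle (_ , _ , iso , arc⇔) =
  ranking⇒noDirectedCycle (proj₁ ∘ Inverse.to iso) (proj₁ ∘ to (arc⇔ _ _))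

alternating4Cycle : {E : ArcSet m n} → IsOrientedBipartite E → ∀ {x₁ x₂ y₁ y₂} →
  Arc E (inj₁ x₁) (inj₂ y₁) → Arc E (inj₂ y₁) (inj₁ x₂) →
  Arc E (inj₁ x₂) (inj₂ y₂) → Arc E (inj₂ y₂) (inj₁ x₁) → DirectedCycleOfLength1+ E 3
alternating4Cycle {m} {n} {E} ob {x₁} {x₂} {y₁} {y₂} x₁y₁ y₁x₂ x₂y₂ y₂x₁ =
  square , injective , arcs
  where
  open IsOrientedBipartite ob

  x₁≢x₂ : x₁ ≢ x₂
  x₁≢x₂ refl = oriented x₁ y₁ (x₁y₁ , y₁x₂)

  y₁≢y₂ : y₁ ≢ y₂
  y₁≢y₂ refl = oriented x₂ y₁ (x₂y₂ , y₁x₂)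

  square : Fin 4 → V m n
  square zero                   = inj₁ x₁
  square (suc zero)             = inj₂ y₁
  square (suc (suc zero))       = inj₁ x₂
  square (suc (suc (suc zero))) = inj₂ y₂

  injective : Injective _≡_ _≡_ square
  injective {zero}                 {zero}                   _ = refl
  injective {suc zero}               {suc zero}               _ = refl
  injective {suc (suc zero)}         {suc (suc zero)}         _ = refl
  injective {suc (suc (suc zero))}   {suc (suc (suc zero))}   _ = refl
  injective {zero}                 {suc (suc zero)}         e = ⊥-elim (x₁≢x₂ (inj₁-injective e))
  injective {suc (suc zero)}         {zero}                   e = ⊥-elim (x₁≢x₂ (sym (inj₁-injective e)))
  injective {suc zero}               {suc (suc (suc zero))}   e = ⊥-elim (y₁≢y₂ (inj₂-injective e))
  injective {suc (suc (suc zero))}   {suc zero}               e = ⊥-elim (y₁≢y₂ (sym (inj₂-injective e)))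
  injective {zero}                 {suc zero}               ()
  injective {zero}                 {suc (suc (suc zero))}   ()
  injective {suc zero}               {zero}                   ()
  injective {suc zero}               {suc (suc zero)}         ()
  injective {suc (suc zero)}         {suc zero}               ()
  injective {suc (suc zero)}         {suc (suc (suc zero))}   ()
  injective {suc (suc (suc zero))}   {zero}                   ()
  injective {suc (suc (suc zero))}   {suc (suc zero)}         ()

  arcs : ∀ i → Arc E (square i) (square (next i))
  arcs zero                   = x₁y₁
  arcs (suc zero)             = y₁x₂
  arcs (suc (suc zero))       = x₂y₂
  arcs (suc (suc (suc zero))) = y₂x₁

module _ {E : ArcSet m n} (bt : IsBitournament E) where
  open IsBitournament bt
  open IsOrientedBipartite isOrientedBipartite

  arc-yx⇔false : ∀ {x y} → Arc E (inj₂ y) (inj₁ x) ⇔ matA E x y ≡ false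
  arc-yx⇔false {x} {y} = mk⇔
    (λ yx → ¬-not λ aₓᵧ → oriented x y (from T-≡ aₓᵧ , yx))
    (λ aₓᵧ → fromComplete (complete x y) aₓᵧ)
    where
    fromComplete : Arc E (inj₁ x) (inj₂ y) ⊎ Arc E (inj₂ y) (inj₁ x) →
                   matA E x y ≡ false → Arc E (inj₂ y) (inj₁ x)
    fromComplete (inj₁ xy) aₓᵧ = contradiction aₓᵧ (not-¬ (to T-≡ xy))
    fromComplete (inj₂ yx) _   = yx

  arc-yx≡not : ∀ x y → E (inj₂ y) (inj₁ x) ≡ not (matA E x y)
  arc-yx≡not x y with matA E x y in aₓᵧ
  ... | true  = ¬-not λ yx → not-¬ aₓᵧ (to arc-yx⇔false (from T-≡ yx))
  ... | false = to T-≡ (from arc-yx⇔false aₓᵧ)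

  adjMatrix≡blockMatrix : ∀ i j → adjMatrix E i j ≡ blockMatrix (matA E) i j
  adjMatrix≡blockMatrix i j with splitAt m i | splitAt m j
  ... | inj₁ x | inj₁ x′ = ¬-not (noArcXX x x′ ∘ from T-≡)
  ... | inj₁ x | inj₂ y  = refl
  ... | inj₂ y | inj₁ x  = arc-yx≡not x y
  ... | inj₂ y | inj₂ y′ = ¬-not (noArcYY y y′ ∘ from T-≡)

  bitransitive⇔ferrers : Bitransitive E ⇔ Ferrers (matA E)
  bitransitive⇔ferrers = mk⇔
    (λ bit x₁ x₂ y₁ y₂ a₁₁ a₂₁ a₂₂ →
      to T-≡ (bit x₁ x₂ y₁ y₂ (from T-≡ a₁₁) (from arc-yx⇔false a₂₁) (from T-≡ a₂₂)))
    (λ fer x₁ x₂ y₁ y₂ x₁y₁ y₁x₂ x₂y₂ →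
      from T-≡ (fer x₁ x₂ y₁ y₂ (to T-≡ x₁y₁) (to arc-yx⇔false y₁x₂) (to T-≡ x₂y₂)))

  bitransitive⇔blockFerrersForm : Bitransitive E ⇔ BlockFerrersForm E
  bitransitive⇔blockFerrersForm = mk⇔
    (λ bit → adjMatrix≡blockMatrix , from ferrersMatrix⇔ferrers (to bitransitive⇔ferrers bit))
    (λ (_ , fm) → from bitransitive⇔ferrers (to ferrersMatrix⇔ferrers fm))

  noDirected4Cycle⇒bitransitive : NoDirected4Cycle E → Bitransitive E
  noDirected4Cycle⇒bitransitive no4 x₁ x₂ y₁ y₂ x₁y₁ y₁x₂ x₂y₂ with matA E x₁ y₂ in aₓ₁ᵧ₂
  ... | true  = tt
  ... | false = ⊥-elim (no4 (alternating4Cycle isOrientedBipartite x₁y₁ y₁x₂ x₂y₂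
                                                (from arc-yx⇔false aₓ₁ᵧ₂)))

  module _ (ferrers : Ferrers (matA E)) where

    level : V m n → ℕ
    level (inj₁ x) = suc (rowRank (matA E) x * 2)
    level (inj₂ y) = columnRank (matA E) y * 2

    arc⇔level⇝ : ∀ u v → Arc E u v ⇔ level u ⇝ level v
    arc⇔level⇝ (inj₁ x) (inj₁ x′) = mk⇔ (⊥-elim ∘ noArcXX x x′)
      (λ (_ , ≢) → ⊥-elim (≢ (trans (odd%2 (rowRank (matA E) x))
                                    (sym (odd%2 (rowRank (matA E) x′))))))
    arc⇔level⇝ (inj₂ y) (inj₂ y′) = mk⇔ (⊥-elim ∘ noArcYY y y′)
      (λ (_ , ≢) → ⊥-elim (≢ (trans (even%2 (columnRank (matA E) y))
                                    (sym (even%2 (columnRank (matA E) y′))))))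
    arc⇔level⇝ (inj₁ x) (inj₂ y) = mk⇔
      (λ xy → to odd<even⇔ (to (threshold {A = matA E} ferrers) (to T-≡ xy)) ,
              odd≢even (rowRank (matA E) x) (columnRank (matA E) y))
      (λ (lt , _) → from T-≡ (from (threshold {A = matA E} ferrers) (from odd<even⇔ lt)))
    arc⇔level⇝ (inj₂ y) (inj₁ x) = mk⇔
      (λ yx → to even<odd⇔ (columnRank≤rowRank {A = matA E} (to arc-yx⇔false yx)) ,
              odd≢even (rowRank (matA E) x) (columnRank (matA E) y) ∘ sym)
      (λ (lt , _) → from arc-yx⇔false (¬-not λ aₓᵧ →
        <⇒≱ (rowRank<columnRank {A = matA E} ferrers aₓᵧ) (from even<odd⇔ lt)))

  bitransitive⇒isoToSomeDS : Bitransitive E → IsoToSomeDS E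
  bitransitive⇒isoToSomeDS bit = pullbackOfDℕ⇒isoToSomeDS (inj₁ (fromℕ< X-nonempty))
    (level ferrers) (arc⇔level⇝ ferrers)
    where
    ferrers : Ferrers (matA E)
    ferrers = to bitransitive⇔ferrers bit

mainTheorem1 : ∀ (m n : ℕ) (E : ArcSet m n) → IsBitournament E →
    (Bitransitive E ⇔ NoDirected4Cycle E) ×
    (Bitransitive E ⇔ NoDirectedCycle E) ×
    (Bitransitive E ⇔ BlockFerrersForm E) ×
    (Bitransitive E ⇔ IsoToSomeDS E)
mainTheorem1 m n E bt =
  mk⇔ (λ bit → acyclic bit 3) no4⇒bit ,
  mk⇔ acyclic (λ noCycle → no4⇒bit (noCycle 3)) ,
  bitransitive⇔blockFerrersForm bt ,
  mk⇔ (bitransitive⇒isoToSomeDS bt) (λ iso → no4⇒bit (isoToSomeDS⇒noDirectedCycle iso 3))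
  where
  no4⇒bit : NoDirected4Cycle E → Bitransitive E
  no4⇒bit = noDirected4Cycle⇒bitransitive bt

  acyclic : Bitransitive E → NoDirectedCycle E
  acyclic = isoToSomeDS⇒noDirectedCycle ∘ bitransitive⇒isoToSomeDS bt
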